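{- Let $\Theta$ be a standard s-substitution, $t$ a standard term, and $p$ a state over the parameters occurring in $\Theta$ and $t$. Then for all parameter assignments $\sigma\in\mathcal S(p)$ we have $\sigma(\mathrm{Ap}(\Theta,t)|_p){\downarrow}=\sigma(t){\downarrow}\,\Theta[\sigma]$, where $\mathrm{Ap}(\Theta,t)|_p=\psi_p(t)\psi_p(\Theta)$.
   Context: Parameters range over natural numbers; numerals are $\bar0,\bar1=s(\bar0),\bar2,\ldots$; a parameter assignment $\sigma$ maps parameters to numerals and evaluates terms built from $\bar0$, parameters, $s$ and $p$ (predecessor, $p(\bar0)=\bar0$). For $k\ge1$, a $k$-ary variable class $X$ is a set of first-order variables $X(\nu_1,\ldots,\nu_k)$ indexed bijectively by $k$-tuples of numerals (distinct classes disjoint); $X(r_1,\ldots,r_k)$ with numeric terms $r_i$ is a variable expression, $\sigma(X(r_1,\ldots,r_k)){\downarrow}=X(\sigma(r_1){\downarrow},\ldots,\sigma(r_k){\downarrow})$. Schematic individual terms are built from constants, variables, variable expressions, first-order function symbols and primitive-recursively defined schematic term symbols $\hat t(s_1,\ldots,s_i,r_1,\ldots,r_j)$; $\sigma(t){\downarrow}$ is the first-order term obtained by evaluating under $\sigma$ and unfolding definitions. Each variable class $X$ of arity $k$ has a fixed parameter list $(m_1,\ldots,m_k)$; $X(r_1,\ldots,r_k)$ is standard if each $r_i\in\{m_i,\bar0,p(m_i),s(m_i)\}$; a standard term has only standard variable expressions. Two variable expressions are parameter-unifiable if some $\sigma$ evaluates them to the same variable. A standard s-substitution is $\Theta=\{A_1\leftarrow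 t_1,\ldots,A_\gamma\leftarrow t_\gamma\}$ with $A_i$ standard variable expressions, $t_i$ standard terms, and $A_i,A_j$ not parameter-unifiable for $i\neq j$; $\Theta[\sigma]=\{\sigma(A_i){\downarrow}\leftarrow\sigma(t_i){\downarrow}\}_i$ (a first-order substitution, applied in the ordinary way to first-order terms). A state over a finite parameter set $\mathcal P$ is a conjunction choosing for each $m\in\mathcal P$ one of: $m=\bar0$; $m\neq\bar0\wedge p(m)=\bar0$; $m\neq\bar0\wedge p(m)\neq\bar0$; $\mathcal S(p)$ is the set of assignments satisfying $p$. $\psi_p$ on a standard variable expression $X(r_1,\ldots,r_k)$ with list $(m_1,\ldots,m_k)$: for each $i$, if $p$ contains $m_i=\bar0$, replace $r_i\in\{m_i,p(m_i),\bar0\}$ by $\bar0$ and $s(m_i)$ by $\bar1$; if $p$ contains $m_i\neq\bar0\wedge p(m_i)=\bar0$, replace $p(m_i)$ by $\bar0$, $m_i$ by $\bar1$, $s(m_i)$ by $\bar2$, leave $\bar0$; otherwise leave $r_i$. $\psi_p$ fixes constants and ordinary variables, is homomorphic over function symbols and individual arguments of schematic symbols (numeric arguments unchanged), and $\psi_p(\Theta)=\{\psi_p(A_i)\leftarrow\psi_p(t_i)\}_i$. For a term $u$ and a set $\Delta=\{B_1\leftarrow u_1,\ldots\}$ with variable expressions $B_j$, $u\Delta$ denotes syntactic application: every occurrence in $u$ of a variable expression syntactically identical to some $B_j$ is replaced by $u_j$. -}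

module Defs where

open import Data.Nat using (ℕ; zero; suc; pred; _≤_)
open import Data.Nat.Properties using () renaming (_≟_ to _≟ℕ_)
open import Data.Fin using (Fin)
open import Data.Vec using (Vec; []; _∷_; map; zipWith; lookup)
open import Data.Vec.Relation.Binary.Pointwise.Inductive using (Pointwise)
open import Data.Vec.Relation.Unary.Any using (Any)
open import Data.List using (List; []; _∷_)
open import Data.List.Relation.Unary.All using (All)
open import Data.List.Relation.Unary.AllPairs using (AllPairs)
open import Data.Product using (Σ; ∃; _×_; _,_; proj₁; proj₂)
open import Data.Sum using (_⊎_; inj₁; inj₂)
open import Data.Bool using (if_then_else_)
open import Relation.Nullary using (¬_; Dec; yes; no)
open import Relation.Nullary.Decidable using (⌊_⌋)
open import Relation.Binary.Definitions using (DecidableEquality)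
open import Relation.Binary.PropositionalEquality using (_≡_; _≢_; refl)
import Data.Vec.Properties as VP

data FTm {F : Set} (ar : F → ℕ) (V : Set) : Set where
  var : V → FTm ar V
  fun : (f : F) → Vec (FTm ar V) (ar f) → FTm ar V

-- Parameters and numerals are both represented by ℕ (parameter names
-- resp. the value n for the numeral n̄).
--
-- A schematic term symbol ĥ with i individual and j numeric arguments
-- is given by its (primitive-recursive) definition; what matters for
-- evaluation is the result of unfolding the definition at numeral
-- arguments ν₁..νⱼ: a first-order term built from function symbols,
-- ordinary variables (inj₁) and the i individual argument slots (inj₂).
-- (The defining equations contain no variable expressions.)

record Sig : Set₁ where
  field
    Class      : Set
    _≟C_       : DecidableEquality Class
    arity      : Class → ℕ
    arity-pos  : ∀ X → 1 ≤ arity X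
    params     : (X : Class) → Vec ℕ (arity X)
    Fun        : Set
    funArity   : Fun → ℕ
    Sch        : Set
    indArity   : Sch → ℕ
    numArity   : Sch → ℕ
    unfold     : (h : Sch) → Vec ℕ (numArity h) → FTm funArity (ℕ ⊎ Fin (indArity h))

data NTm : Set where
  zero' : NTm
  par   : ℕ → NTm
  s     : NTm → NTm
  p     : NTm → NTm

PAssign : Set
PAssign = ℕ → ℕ

evalN : PAssign → NTm → ℕ
evalN σ zero'   = zero
evalN σ (par m) = σ m
evalN σ (s r)   = suc (evalN σ r)
evalN σ (p r)   = pred (evalN σ r)

_≟N_ : DecidableEquality NTm
zero' ≟N zero' = yes refl
zero' ≟N par _ = no λ ()
zero' ≟N s _ = no λ ()
zero' ≟N p _ = no λ ()
par _ ≟N zero' = no λ ()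
par m ≟N par k with m ≟ℕ k
... | yes refl = yes refl
... | no m≢k = no λ { refl → m≢k refl }
par _ ≟N s _ = no λ ()
par _ ≟N p _ = no λ ()
s _ ≟N zero' = no λ ()
s _ ≟N par _ = no λ ()
s r ≟N s r' with r ≟N r'
... | yes refl = yes refl
... | no ne = no λ { refl → ne refl }
s _ ≟N p _ = no λ ()
p _ ≟N zero' = no λ ()
p _ ≟N par _ = no λ ()
p _ ≟N s _ = no λ ()
p r ≟N p r' with r ≟N r'
... | yes refl = yes refl
... | no ne = no λ { refl → ne refl }

data OccN (m : ℕ) : NTm → Set where
  here : OccN m (par m)
  ins  : ∀ {r} → OccN m r → OccN m (s r)
  inp  : ∀ {r} → OccN m r → OccN m (p r)

data Choice : Set where
  isZero isOne isBig : Choice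

Holds : PAssign → ℕ → Choice → Set
Holds σ m isZero = evalN σ (par m) ≡ zero
Holds σ m isOne  = evalN σ (par m) ≢ zero × evalN σ (p (par m)) ≡ zero
Holds σ m isBig  = evalN σ (par m) ≢ zero × evalN σ (p (par m)) ≢ zero

-- ψ_p on a single argument r_i of a variable expression whose list
-- entry is the parameter m (with choice c = p(m)).
psiArg : Choice → ℕ → NTm → NTm
psiArg isZero m zero'       = zero'
psiArg isZero m (par k)     = if ⌊ m ≟ℕ k ⌋ then zero' else par k
psiArg isZero m (p (par k)) = if ⌊ m ≟ℕ k ⌋ then zero' else p (par k)
psiArg isZero m (s (par k)) = if ⌊ m ≟ℕ k ⌋ then s zero' else s (par k)
psiArg isZero m r           = r
psiArg isOne  m (p (par k)) = if ⌊ m ≟ℕ k ⌋ then zero' else p (par k)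
psiArg isOne  m (par k)     = if ⌊ m ≟ℕ k ⌋ then s zero' else par k
psiArg isOne  m (s (par k)) = if ⌊ m ≟ℕ k ⌋ then s (s zero') else s (par k)
psiArg isOne  m r           = r
psiArg isBig  m r           = r

module _ (S : Sig) where
  open Sig S

  data FVar : Set where
    ord : ℕ → FVar
    cls : (X : Class) → Vec ℕ (arity X) → FVar

  FOTerm : Set
  FOTerm = FTm funArity FVar

  data VExp : Set where
    vx : (X : Class) → Vec NTm (arity X) → VExp

  evalV : PAssign → VExp → FVar
  evalV σ (vx X rs) = cls X (map (evalN σ) rs)

  _≟FV_ : DecidableEquality FVar
  ord x ≟FV ord y with x ≟ℕ y
  ... | yes refl = yes refl
  ... | no ne = no λ { refl → ne refl }
  ord _ ≟FV cls _ _ = no λ ()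
  cls _ _ ≟FV ord _ = no λ ()
  cls X v ≟FV cls Y w with X ≟C Y
  ... | no ne = no λ { refl → ne refl }
  ... | yes refl with VP.≡-dec _≟ℕ_ v w
  ...   | yes refl = yes refl
  ...   | no ne = no λ { refl → ne refl }

  _≟VE_ : DecidableEquality VExp
  vx X v ≟VE vx Y w with X ≟C Y
  ... | no ne = no λ { refl → ne refl }
  ... | yes refl with VP.≡-dec _≟N_ v w
  ...   | yes refl = yes refl
  ...   | no ne = no λ { refl → ne refl }

  data STm : Set where
    ovar : ℕ → STm
    vexp : VExp → STm
    fun  : (f : Fun) → Vec STm (funArity f) → STm
    sch  : (h : Sch) → Vec STm (indArity h) → Vec NTm (numArity h) → STm

  mutual
    inst : ∀ {i} → Vec FOTerm i → FTm funArity (ℕ ⊎ Fin i) → FOTerm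
    inst us (var (inj₁ x)) = var (ord x)
    inst us (var (inj₂ k)) = lookup us k
    inst us (fun f ts)     = fun f (insts us ts)

    insts : ∀ {i n} → Vec FOTerm i → Vec (FTm funArity (ℕ ⊎ Fin i)) n → Vec FOTerm n
    insts us []       = []
    insts us (t ∷ ts) = inst us t ∷ insts us ts

  mutual
    evalT : PAssign → STm → FOTerm
    evalT σ (ovar x)      = var (ord x)
    evalT σ (vexp A)      = var (evalV σ A)
    evalT σ (fun f ts)    = fun f (evalTs σ ts)
    evalT σ (sch h ts rs) = inst (evalTs σ ts) (unfold h (map (evalN σ) rs))

    evalTs : ∀ {n} → PAssign → Vec STm n → Vec FOTerm n
    evalTs σ []       = []
    evalTs σ (t ∷ ts) = evalT σ t ∷ evalTs σ ts

  data StdArg (m : ℕ) : NTm → Set where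
    std-m : StdArg m (par m)
    std-0 : StdArg m zero'
    std-p : StdArg m (p (par m))
    std-s : StdArg m (s (par m))

  StdVExp : VExp → Set
  StdVExp (vx X rs) = Pointwise StdArg (params X) rs

  mutual
    data StdTm : STm → Set where
      std-ovar : ∀ {x} → StdTm (ovar x)
      std-vexp : ∀ {A} → StdVExp A → StdTm (vexp A)
      std-fun  : ∀ {f ts} → StdTms ts → StdTm (fun f ts)
      std-sch  : ∀ {h ts rs} → StdTms ts → StdTm (sch h ts rs)

    data StdTms : ∀ {n} → Vec STm n → Set where
      []  : StdTms []
      _∷_ : ∀ {n t} {ts : Vec STm n} → StdTm t → StdTms ts → StdTms (t ∷ ts)

  ParamUnifiable : VExp → VExp → Set
  ParamUnifiable A B = ∃ λ (σ : PAssign) → evalV σ A ≡ evalV σ B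

  SSub : Set
  SSub = List (VExp × STm)

  StdSSub : SSub → Set
  StdSSub Θ = All (λ At → StdVExp (proj₁ At) × StdTm (proj₂ At)) Θ
            × AllPairs (λ At Bu → ¬ ParamUnifiable (proj₁ At) (proj₁ Bu)) Θ

  FOSub : Set
  FOSub = List (FVar × FOTerm)

  lookupFV : FOSub → FVar → FOTerm
  lookupFV []             v = var v
  lookupFV ((w , u) ∷ θ) v = if ⌊ w ≟FV v ⌋ then u else lookupFV θ v

  mutual
    applyFO : FOSub → FOTerm → FOTerm
    applyFO θ (var v)    = lookupFV θ v
    applyFO θ (fun f ts) = fun f (applyFOs θ ts)

    applyFOs : ∀ {n} → FOSub → Vec FOTerm n → Vec FOTerm n
    applyFOs θ []       = []
    applyFOs θ (t ∷ ts) = applyFO θ t ∷ applyFOs θ ts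

  instSub : SSub → PAssign → FOSub
  instSub []             σ = []
  instSub ((A , t) ∷ Θ) σ = (evalV σ A , evalT σ t) ∷ instSub Θ σ

  lookupVE : SSub → VExp → STm
  lookupVE []             A = vexp A
  lookupVE ((B , u) ∷ Δ) A = if ⌊ B ≟VE A ⌋ then u else lookupVE Δ A

  mutual
    applyS : SSub → STm → STm
    applyS Δ (ovar x)      = ovar x
    applyS Δ (vexp A)      = lookupVE Δ A
    applyS Δ (fun f ts)    = fun f (applySs Δ ts)
    applyS Δ (sch h ts rs) = sch h (applySs Δ ts) rs

    applySs : ∀ {n} → SSub → Vec STm n → Vec STm n
    applySs Δ []       = []
    applySs Δ (t ∷ ts) = applyS Δ t ∷ applySs Δ ts

  -- ψ_p, where the state is given by st : ℕ → Choice
  psiV : (ℕ → Choice) → VExp → VExp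
  psiV st (vx X rs) = vx X (zipWith (λ m r → psiArg (st m) m r) (params X) rs)

  mutual
    psiT : (ℕ → Choice) → STm → STm
    psiT st (ovar x)      = ovar x
    psiT st (vexp A)      = vexp (psiV st A)
    psiT st (fun f ts)    = fun f (psiTs st ts)
    psiT st (sch h ts rs) = sch h (psiTs st ts) rs

    psiTs : ∀ {n} → (ℕ → Choice) → Vec STm n → Vec STm n
    psiTs st []       = []
    psiTs st (t ∷ ts) = psiT st t ∷ psiTs st ts

  psiS : (ℕ → Choice) → SSub → SSub
  psiS st []             = []
  psiS st ((A , t) ∷ Θ) = (psiV st A , psiT st t) ∷ psiS st Θ

  Ap : (ℕ → Choice) → SSub → STm → STm
  Ap st Θ t = applyS (psiS st Θ) (psiT st t)

  OccV : ℕ → VExp → Set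
  OccV m (vx X rs) = Any (OccN m) rs

  mutual
    data OccT (m : ℕ) : STm → Set where
      in-vexp : ∀ {A} → OccV m A → OccT m (vexp A)
      in-fun  : ∀ {f ts} → OccTs m ts → OccT m (fun f ts)
      in-schT : ∀ {h ts rs} → OccTs m ts → OccT m (sch h ts rs)
      in-schN : ∀ {h ts rs} → Any (OccN m) rs → OccT m (sch h ts rs)

    data OccTs (m : ℕ) : ∀ {n} → Vec STm n → Set where
      here  : ∀ {n t} {ts : Vec STm n} → OccT m t → OccTs m (t ∷ ts)
      there : ∀ {n t} {ts : Vec STm n} → OccTs m ts → OccTs m (t ∷ ts)

  OccS : ℕ → SSub → Set
  OccS m Θ = Data.List.Relation.Unary.Any.Any (λ At → OccV m (proj₁ At) ⊎ OccT m (proj₂ At)) Θ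
    where import Data.List.Relation.Unary.Any

  OccIn : ℕ → SSub → STm → Set
  OccIn m Θ t = OccS m Θ ⊎ OccT m t

  InStates : PAssign → (ℕ → Choice) → SSub → STm → Set
  InStates σ st Θ t = ∀ m → OccIn m Θ t → Holds σ m (st m)

{-# OPTIONS --safe #-}
-- Under σ ∈ 𝒮(p), ψ_p turns a standard argument r at parameter m into the numeral σ(r) when p
-- pins σ(m) to 0 or 1, and leaves r alone when σ(m) ≥ 2, where 0̄, p(m), m and s(m) take four
-- distinct values. Hence for standard variable expressions A, B we get σ(ψ_p A) = σ(A), and
-- ψ_p A = ψ_p B iff σ(A) = σ(B); so looking up ψ_p A in ψ_p(Θ) stops at the entry whose instance
-- is the first match of σ(A) in Θ[σ]. Induction on t does the rest: unfolded schematic symbols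
-- contain no class variables, so Θ[σ] commutes with unfolding.
module Submission where

open import Defs
open import Data.Nat using (ℕ; zero; suc; pred; _+_; _≤_; z≤n; s≤s)
open import Data.Nat.Properties using (1+n≢n; m≢1+n+m) renaming (_≟_ to _≟ℕ_)
open import Data.Fin using (Fin)
import Data.Fin as Fin
open import Data.Vec using (Vec; []; _∷_; map; zipWith; lookup)
open import Data.Vec.Properties using (∷-injective)
open import Data.Vec.Relation.Binary.Pointwise.Inductive using (Pointwise; []; _∷_)
open import Data.Vec.Relation.Unary.Any using (Any; here; there)
import Data.List.Relation.Unary.Any as List
open import Data.List using ([]; _∷_)
open import Data.List.Relation.Unary.All using (All; []; _∷_)
open import Data.Product using (_×_; _,_; proj₁; proj₂)
open import Data.Sum using (_⊎_; inj₁; inj₂)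
open import Data.Bool using (if_then_else_)
open import Function using (_∘_)
open import Function.Bundles using (_⇔_; mk⇔; Equivalence)
open import Relation.Nullary using (yes; no; contradiction)
open import Relation.Nullary.Decidable using (⌊_⌋)
open import Relation.Binary.PropositionalEquality
  using (_≡_; refl; sym; trans; cong; cong₂; module ≡-Reasoning)

numeral : ℕ → NTm
numeral zero    = zero'
numeral (suc n) = s (numeral n)

evalN-numeral : ∀ σ n → evalN σ (numeral n) ≡ n
evalN-numeral σ zero    = refl
evalN-numeral σ (suc n) = cong suc (evalN-numeral σ n)

if-≟-refl : ∀ {A : Set} m {x y : A} → (if ⌊ m ≟ℕ m ⌋ then x else y) ≡ x
if-≟-refl m with m ≟ℕ m
... | yes _  = refl
... | no m≢m = contradiction refl m≢m

psiArg-zero' : ∀ c m → psiArg c m zero' ≡ zero'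
psiArg-zero' isZero m = refl
psiArg-zero' isOne  m = refl
psiArg-zero' isBig  m = refl

-- The choices under which ψ_p replaces standard arguments by numerals, and the value of m they force.
data Pinned : Choice → ℕ → Set where
  at-0 : Pinned isZero 0
  at-1 : Pinned isOne 1

data Regime : Choice → ℕ → Set where
  pinned : ∀ {c n} → Pinned c n → Regime c n
  big    : ∀ {n} → 2 ≤ n → Regime isBig n

holds-regime : ∀ {σ m} c → Holds σ m c → Regime c (σ m)
holds-regime isZero h rewrite h = pinned at-0
holds-regime {σ} {m} isOne (n≢0 , pn≡0) with σ m
... | zero        = contradiction refl n≢0
... | suc zero    = pinned at-1
... | suc (suc _) = contradiction pn≡0 λ ()
holds-regime {σ} {m} isBig (n≢0 , pn≢0) with σ m
... | zero        = contradiction refl n≢0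
... | suc zero    = contradiction refl pn≢0
... | suc (suc _) = big (s≤s (s≤s z≤n))

module _ {S : Sig} where
  open Sig S using (Class; arity)

  stdValue : ∀ {m r} → StdArg S m r → ℕ → ℕ
  stdValue std-m n = n
  stdValue std-0 n = 0
  stdValue std-p n = pred n
  stdValue std-s n = suc n

  evalN-std : ∀ σ {m r} (a : StdArg S m r) → evalN σ r ≡ stdValue a (σ m)
  evalN-std σ std-m = refl
  evalN-std σ std-0 = refl
  evalN-std σ std-p = refl
  evalN-std σ std-s = refl

  std-zero'-or-occurs : ∀ {m r} → StdArg S m r → r ≡ zero' ⊎ OccN m r
  std-zero'-or-occurs std-m = inj₂ here
  std-zero'-or-occurs std-0 = inj₁ refl
  std-zero'-or-occurs std-p = inj₂ (inp here)
  std-zero'-or-occurs std-s = inj₂ (ins here)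

  psiArg-pinned : ∀ {c n m r} → Pinned c n → (a : StdArg S m r) →
                  psiArg c m r ≡ numeral (stdValue a n)
  psiArg-pinned at-0 std-0 = refl
  psiArg-pinned at-1  std-0 = refl
  psiArg-pinned {m = m} at-0 std-m = if-≟-refl m
  psiArg-pinned {m = m} at-0 std-p = if-≟-refl m
  psiArg-pinned {m = m} at-0 std-s = if-≟-refl m
  psiArg-pinned {m = m} at-1 std-m = if-≟-refl m
  psiArg-pinned {m = m} at-1 std-p = if-≟-refl m
  psiArg-pinned {m = m} at-1 std-s = if-≟-refl m

  stdValue-injective : ∀ k {m r r'} (a : StdArg S m r) (b : StdArg S m r') →
                       stdValue a (2 + k) ≡ stdValue b (2 + k) → r ≡ r'
  stdValue-injective k std-m std-m e = refl
  stdValue-injective k std-m std-0 ()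
  stdValue-injective k std-m std-p e = contradiction e 1+n≢n
  stdValue-injective k std-m std-s e = contradiction (sym e) 1+n≢n
  stdValue-injective k std-0 std-m ()
  stdValue-injective k std-0 std-0 e = refl
  stdValue-injective k std-0 std-p ()
  stdValue-injective k std-0 std-s ()
  stdValue-injective k std-p std-m e = contradiction (sym e) 1+n≢n
  stdValue-injective k std-p std-0 ()
  stdValue-injective k std-p std-p e = refl
  stdValue-injective k std-p std-s e = contradiction e (m≢1+n+m (suc k) {1})
  stdValue-injective k std-s std-m e = contradiction e 1+n≢n
  stdValue-injective k std-s std-0 ()
  stdValue-injective k std-s std-p e = contradiction (sym e) (m≢1+n+m (suc k) {1})
  stdValue-injective k std-s std-s e = refl

  psiArg-respects-stdValue : ∀ {c n m r r'} → Regime c n → (a : StdArg S m r) (b : StdArg S m r') →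
                             stdValue a n ≡ stdValue b n → psiArg c m r ≡ psiArg c m r'
  psiArg-respects-stdValue (pinned π) a b e =
    trans (psiArg-pinned π a) (trans (cong numeral e) (sym (psiArg-pinned π b)))
  psiArg-respects-stdValue (big (s≤s (s≤s _))) a b e = stdValue-injective _ a b e

  cls-injectiveˡ : ∀ {X Y : Class} {v w} → cls {S} X v ≡ cls Y w → X ≡ Y
  cls-injectiveˡ refl = refl

  cls-injectiveʳ : ∀ {X : Class} {v w : Vec ℕ (arity X)} → cls {S} X v ≡ cls X w → v ≡ w
  cls-injectiveʳ refl = refl

  StdEntries : SSub S → Set
  StdEntries = All λ At → StdVExp S (proj₁ At) × StdTm S (proj₂ At)

  lookupFV-instSub-ord : ∀ Θ σ x → lookupFV S (instSub S Θ σ) (ord x) ≡ var (ord x)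
  lookupFV-instSub-ord []                 σ x = refl
  lookupFV-instSub-ord ((vx _ _ , _) ∷ Θ) σ x = lookupFV-instSub-ord Θ σ x

  lookup-applyFOs : ∀ θ {i} (us : Vec (FOTerm S) i) (k : Fin i) →
                    lookup (applyFOs S θ us) k ≡ applyFO S θ (lookup us k)
  lookup-applyFOs θ (u ∷ us) Fin.zero    = refl
  lookup-applyFOs θ (u ∷ us) (Fin.suc k) = lookup-applyFOs θ us k

  module _ {θ : FOSub S} (θ-fixes-ord : ∀ x → lookupFV S θ (ord x) ≡ var (ord x)) where
    mutual
      applyFO-inst : ∀ {i} (us : Vec (FOTerm S) i) U →
                     applyFO S θ (inst S us U) ≡ inst S (applyFOs S θ us) U
      applyFO-inst us (var (inj₁ x)) = θ-fixes-ord x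
      applyFO-inst us (var (inj₂ k)) = sym (lookup-applyFOs θ us k)
      applyFO-inst us (fun f Us)     = cong (fun f) (applyFOs-insts us Us)

      applyFOs-insts : ∀ {i n} (us : Vec (FOTerm S) i) (Us : Vec _ n) →
                       applyFOs S θ (insts S us Us) ≡ insts S (applyFOs S θ us) Us
      applyFOs-insts us []       = refl
      applyFOs-insts us (U ∷ Us) = cong₂ _∷_ (applyFO-inst us U) (applyFOs-insts us Us)

module _ {S : Sig} (σ : PAssign) (st : ℕ → Choice) where
  open Sig S using (unfold)

  HoldsOn : (ℕ → Set) → Set
  HoldsOn Occ = ∀ {m} → Occ m → Holds σ m (st m)

  psiArgs : ∀ {n} → Vec ℕ n → Vec NTm n → Vec NTm n
  psiArgs = zipWith λ m r → psiArg (st m) m r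

  regime-evalN-psiArg : ∀ {c m r} → Regime c (σ m) → (a : StdArg S m r) →
                        evalN σ (psiArg c m r) ≡ evalN σ r
  regime-evalN-psiArg {c} {m} {r} (pinned π) a = begin
    evalN σ (psiArg c m r)               ≡⟨ cong (evalN σ) (psiArg-pinned π a) ⟩
    evalN σ (numeral (stdValue a (σ m))) ≡⟨ evalN-numeral σ _ ⟩
    stdValue a (σ m)                     ≡⟨ sym (evalN-std σ a) ⟩
    evalN σ r                            ∎
    where open ≡-Reasoning
  regime-evalN-psiArg (big _) a = refl

  regime-psiArg-injective : ∀ {c m r r'} → Regime c (σ m) →
                            (a : StdArg S m r) (b : StdArg S m r') →
                            evalN σ r ≡ evalN σ r' → psiArg c m r ≡ psiArg c m r'
  regime-psiArg-injective ρ a b e =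
    psiArg-respects-stdValue ρ a b (trans (sym (evalN-std σ a)) (trans e (evalN-std σ b)))

  evalN-psiArg : ∀ {m r} (a : StdArg S m r) → (OccN m r → Holds σ m (st m)) →
                 evalN σ (psiArg (st m) m r) ≡ evalN σ r
  evalN-psiArg {m} a h with std-zero'-or-occurs a
  ... | inj₁ refl = cong (evalN σ) (psiArg-zero' (st m) m)
  ... | inj₂ o    = regime-evalN-psiArg (holds-regime (st m) (h o)) a

  psiArg-injective : ∀ {m r r'} (a : StdArg S m r) (b : StdArg S m r') →
                     (OccN m r → Holds σ m (st m)) → (OccN m r' → Holds σ m (st m)) →
                     evalN σ r ≡ evalN σ r' → psiArg (st m) m r ≡ psiArg (st m) m r'
  psiArg-injective {m} a b h h' e with std-zero'-or-occurs a | std-zero'-or-occurs b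
  ... | inj₁ refl | inj₁ refl = refl
  ... | inj₂ o    | _         = regime-psiArg-injective (holds-regime (st m) (h o)) a b e
  ... | inj₁ _    | inj₂ o'   = regime-psiArg-injective (holds-regime (st m) (h' o')) a b e

  evalN-psiArgs : ∀ {n} {ms : Vec ℕ n} {rs} → Pointwise (StdArg S) ms rs →
                  HoldsOn (λ m → Any (OccN m) rs) →
                  map (evalN σ) (psiArgs ms rs) ≡ map (evalN σ) rs
  evalN-psiArgs []       h = refl
  evalN-psiArgs (a ∷ as) h = cong₂ _∷_ (evalN-psiArg a (h ∘ here)) (evalN-psiArgs as (h ∘ there))

  psiArgs-injective : ∀ {n} {ms : Vec ℕ n} {rs rs'} →
                      Pointwise (StdArg S) ms rs → Pointwise (StdArg S) ms rs' →
                      HoldsOn (λ m → Any (OccN m) rs) → HoldsOn (λ m → Any (OccN m) rs') →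
                      map (evalN σ) rs ≡ map (evalN σ) rs' → psiArgs ms rs ≡ psiArgs ms rs'
  psiArgs-injective []       []       h h' e = refl
  psiArgs-injective (a ∷ as) (b ∷ bs) h h' e with e₁ , e₂ ← ∷-injective e =
    cong₂ _∷_ (psiArg-injective a b (h ∘ here) (h' ∘ here) e₁)
              (psiArgs-injective as bs (h ∘ there) (h' ∘ there) e₂)

  evalV-psiV : ∀ A → StdVExp S A → HoldsOn (λ m → OccV S m A) →
               evalV S σ (psiV S st A) ≡ evalV S σ A
  evalV-psiV (vx X rs) sA h = cong (cls X) (evalN-psiArgs sA h)

  psiV-injective : ∀ A B → StdVExp S A → StdVExp S B →
                   HoldsOn (λ m → OccV S m A) → HoldsOn (λ m → OccV S m B) →
                   evalV S σ A ≡ evalV S σ B → psiV S st A ≡ psiV S st B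
  psiV-injective (vx X v) (vx Y w) sA sB hA hB e with refl ← cls-injectiveˡ e =
    cong (vx X) (psiArgs-injective sA sB hA hB (cls-injectiveʳ e))

  psiV-≡⇔evalV-≡ : ∀ A B → StdVExp S A → StdVExp S B →
                   HoldsOn (λ m → OccV S m A) → HoldsOn (λ m → OccV S m B) →
                   psiV S st A ≡ psiV S st B ⇔ evalV S σ A ≡ evalV S σ B
  psiV-≡⇔evalV-≡ A B sA sB hA hB = mk⇔ evalV-≡ (psiV-injective A B sA sB hA hB)
    where
    open ≡-Reasoning
    evalV-≡ : psiV S st A ≡ psiV S st B → evalV S σ A ≡ evalV S σ B
    evalV-≡ ψ≡ = begin
      evalV S σ A              ≡⟨ sym (evalV-psiV A sA hA) ⟩
      evalV S σ (psiV S st A)  ≡⟨ cong (evalV S σ) ψ≡ ⟩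
      evalV S σ (psiV S st B)  ≡⟨ evalV-psiV B sB hB ⟩
      evalV S σ B              ∎

  mutual
    evalT-psiT : ∀ {u} → StdTm S u → HoldsOn (λ m → OccT S m u) →
                 evalT S σ (psiT S st u) ≡ evalT S σ u
    evalT-psiT std-ovar                   h = refl
    evalT-psiT {vexp A} (std-vexp sA)     h = cong var (evalV-psiV A sA (h ∘ in-vexp))
    evalT-psiT {fun f _} (std-fun sts)    h = cong (fun f) (evalTs-psiTs sts (h ∘ in-fun))
    evalT-psiT {sch f _ rs} (std-sch sts) h =
      cong (λ us → inst S us (unfold f (map (evalN σ) rs))) (evalTs-psiTs sts (h ∘ in-schT))

    evalTs-psiTs : ∀ {n} {us : Vec (STm S) n} → StdTms S us → HoldsOn (λ m → OccTs S m us) →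
                   evalTs S σ (psiTs S st us) ≡ evalTs S σ us
    evalTs-psiTs []         h = refl
    evalTs-psiTs (su ∷ sus) h = cong₂ _∷_ (evalT-psiT su (h ∘ here)) (evalTs-psiTs sus (h ∘ there))

  lookupVE-psiS : ∀ {Θ} → StdEntries Θ → HoldsOn (λ m → OccS S m Θ) →
                  ∀ A → StdVExp S A → HoldsOn (λ m → OccV S m A) →
                  evalT S σ (lookupVE S (psiS S st Θ) (psiV S st A))
                    ≡ lookupFV S (instSub S Θ σ) (evalV S σ A)
  lookupVE-psiS [] _ A sA hA = cong var (evalV-psiV A sA hA)
  lookupVE-psiS {(B , u) ∷ Θ} ((sB , su) ∷ sΘ) hΘ A sA hA
    with _≟VE_ S (psiV S st B) (psiV S st A) | _≟FV_ S (evalV S σ B) (evalV S σ A)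
       | psiV-≡⇔evalV-≡ B A sB sA (hΘ ∘ List.here ∘ inj₁) hA
  ... | yes _  | yes _  | _    = evalT-psiT su (hΘ ∘ List.here ∘ inj₂)
  ... | no _   | no _   | _    = lookupVE-psiS sΘ (hΘ ∘ List.there) A sA hA
  ... | yes ψ≡ | no σ≢  | same = contradiction (Equivalence.to same ψ≡) σ≢
  ... | no ψ≢  | yes σ≡ | same = contradiction (Equivalence.from same σ≡) ψ≢

  module _ {Θ : SSub S} (sΘ : StdEntries Θ) (hΘ : HoldsOn (λ m → OccS S m Θ)) where
    mutual
      evalT-Ap : ∀ {u} → StdTm S u → HoldsOn (λ m → OccT S m u) →
                 evalT S σ (Ap S st Θ u) ≡ applyFO S (instSub S Θ σ) (evalT S σ u)
      evalT-Ap {ovar x} std-ovar          h = sym (lookupFV-instSub-ord Θ σ x)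
      evalT-Ap {vexp A} (std-vexp sA)     h = lookupVE-psiS sΘ hΘ A sA (h ∘ in-vexp)
      evalT-Ap {fun f _} (std-fun sts)    h = cong (fun f) (evalTs-Aps sts (h ∘ in-fun))
      evalT-Ap {sch f ts rs} (std-sch sts) h = begin
        inst S (evalTs S σ (applySs S (psiS S st Θ) (psiTs S st ts))) U
          ≡⟨ cong (λ us → inst S us U) (evalTs-Aps sts (h ∘ in-schT)) ⟩
        inst S (applyFOs S (instSub S Θ σ) (evalTs S σ ts)) U
          ≡⟨ sym (applyFO-inst (lookupFV-instSub-ord Θ σ) (evalTs S σ ts) U) ⟩
        applyFO S (instSub S Θ σ) (inst S (evalTs S σ ts) U)
          ∎
        where
        open ≡-Reasoning
        U = unfold f (map (evalN σ) rs)

      evalTs-Aps : ∀ {n} {us : Vec (STm S) n} → StdTms S us → HoldsOn (λ m → OccTs S m us) →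
                   evalTs S σ (applySs S (psiS S st Θ) (psiTs S st us))
                     ≡ applyFOs S (instSub S Θ σ) (evalTs S σ us)
      evalTs-Aps []         h = refl
      evalTs-Aps (su ∷ sus) h = cong₂ _∷_ (evalT-Ap su (h ∘ here)) (evalTs-Aps sus (h ∘ there))

theorem1 : (S : Sig) (Θ : SSub S) (t : STm S) → StdSSub S Θ → StdTm S t →
    (st : ℕ → Choice) (σ : PAssign) → InStates S σ st Θ t →
    evalT S σ (Ap S st Θ t) ≡ applyFO S (instSub S Θ σ) (evalT S σ t)
theorem1 S Θ t (sΘ , _) stdt st σ h =
  evalT-Ap σ st sΘ (λ o → h _ (inj₁ o)) stdt (λ o → h _ (inj₂ o))
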